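{- Let $G=(V,E)$ be a $3$-edge-connected multigraph, $r\in V$, and let $(H,\phi,\psi)$ be a cut tree of $G$ as defined below, with $H$ rooted at $\psi(r)$. Let $v,u$ be vertices of $H$ with $v$ an ancestor of $u$, and let $e_1,\dots,e_k$ be the edges of the path from $v$ to $u$ in $H$, in order. Then for all $1\le i<j\le k$, $|P(\phi^{ -1}(e_i))|>|P(\phi^{ -1}(e_j))|$.
   Context: A $3$-edge-connected graph is connected and stays connected after deleting any at most $2$ edges; a $3$-edge-cut is a set of $3$ edges whose removal disconnects $G$; $\mathcal{C}$ is the set of all $3$-edge-cuts (for each $c\in\mathcal{C}$, $G\setminus c$ has exactly two components). A cut tree of $G$ is a tree $H=(U,F)$ with a bijection $\phi:\mathcal{C}\to F$ and a map $\psi:V\to U$ such that for every $c\in\mathcal{C}$ splitting $V$ into the two components' vertex sets $V_1,V_2$, removing $\phi(c)$ splits $U$ into $U_1,U_2$ with $\psi^{ -1}(U_1)=V_1$ and $\psi^{ -1}(U_2)=V_2$. For $c\in\mathcal{C}$, $P(c)$ is the vertex set of the component of $G\setminus c$ not containing $r$. -}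

module Defs where

open import Data.Nat using (ℕ; _≤_; _<_)
open import Data.Fin using (Fin)
open import Data.Fin.Subset using (Subset; _∈_; _∉_; ∣_∣; ⁅_⁆; ⊥)
open import Data.List using (List; []; _∷_; _++_; length; lookup)
open import Data.List.Relation.Unary.Unique.Propositional using (Unique)
open import Data.Product using (Σ; _×_; _,_; ∃; ∃-syntax)
open import Data.Sum using (_⊎_)
open import Relation.Binary.PropositionalEquality using (_≡_)
open import Relation.Nullary using (¬_)
open import Function.Bundles using (_⇔_)

record Graph : Set where
  field
    nV : ℕ
    nE : ℕ
    ends : Fin nE → Fin nV × Fin nV
open Graph public

Joins : (G : Graph) → Fin (nE G) → Fin (nV G) → Fin (nV G) → Set
Joins G e a b = (ends G e ≡ (a , b)) ⊎ (ends G e ≡ (b , a))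

data Reach (G : Graph) (S : Subset (nE G)) (x : Fin (nV G)) : Fin (nV G) → Set where
  here : Reach G S x x
  step : ∀ {y z} (e : Fin (nE G)) → Reach G S x y → e ∉ S → Joins G e y z → Reach G S x z

ConnectedWithout : (G : Graph) → Subset (nE G) → Set
ConnectedWithout G S = ∀ x y → Reach G S x y

Connected : Graph → Set
Connected G = ConnectedWithout G ⊥

ThreeEdgeConnected : Graph → Set
ThreeEdgeConnected G = Connected G × (∀ S → ∣ S ∣ ≤ 2 → ConnectedWithout G S)

IsThreeCut : (G : Graph) → Subset (nE G) → Set
IsThreeCut G S = ∣ S ∣ ≡ 3 × ¬ ConnectedWithout G S

IsTree : Graph → Set
IsTree H = Connected H × (∀ f → ¬ ConnectedWithout H ⁅ f ⁆)

record CutTree (G : Graph) : Set₁ where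
  field
    H : Graph
    isTree : IsTree H
    φ : Subset (nE G) → Fin (nE H)   -- only meaningful on 3-edge-cuts
    ψ : Fin (nV G) → Fin (nV H)
    φ-inj : ∀ c c' → IsThreeCut G c → IsThreeCut G c' → φ c ≡ φ c' → c ≡ c'
    φ-surj : ∀ f → ∃[ c ] (IsThreeCut G c × φ c ≡ f)
    compat : ∀ c → IsThreeCut G c → ∀ x y →
             Reach G c x y ⇔ Reach H ⁅ φ c ⁆ (ψ x) (ψ y)

data Walk (G : Graph) : Fin (nV G) → Fin (nV G) → List (Fin (nV G)) → List (Fin (nE G)) → Set where
  []   : ∀ {a} → Walk G a a (a ∷ []) []
  step : ∀ {a b c vs es} (e : Fin (nE G)) → Joins G e a b → Walk G b c vs es → Walk G a c (a ∷ vs) (e ∷ es)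

Path : (G : Graph) → Fin (nV G) → Fin (nV G) → List (Fin (nE G)) → Set
Path G a b es = Σ (List (Fin (nV G))) λ vs → Walk G a b vs es × Unique vs

Ancestor : (H : Graph) (ρ v u : Fin (nV H)) → Set
Ancestor H ρ v u = ∃[ es₁ ] ∃[ es₂ ] (Path H ρ v es₁ × Path H v u es₂ × Path H ρ u (es₁ ++ es₂))

-- s is (the characteristic subset of) P(c): the vertices not reachable from r in G \ c
IsP : (G : Graph) (r : Fin (nV G)) (c : Subset (nE G)) → Subset (nV G) → Set
IsP G r c s = ∀ x → x ∈ s ⇔ (¬ Reach G c r x)

-- Removing a deeper edge of a root path in a tree cuts off part of what removing a
-- shallower one cuts off; through the cut tree this gives P(c') ⊆ P(c). The inclusion is
-- strict because a 3-edge-cut is determined by P(c): by 3-edge-connectivity every edge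
-- of c crosses between P(c) and its complement, and no other edge does.
module Submission where

open import Defs
open import Data.Nat using (zero; suc; _<_; _≤_; s≤s)
open import Data.Nat.Properties using (≤-pred)
open import Data.Fin using (Fin; zero; suc) renaming (_<_ to _<ᶠ_)
open import Data.Fin.Properties using (∀-cons) renaming (_≟_ to _≟ᶠ_)
open import Data.Fin.Subset using (Subset; ∣_∣; _∈_; _∉_; ⁅_⁆; _-_; _⊆_; _⊂_)
open import Data.Fin.Subset.Properties
  using (_∈?_; _⊂?_; x∈⁅y⁆⇒x≡y; x≢y⇒x∉⁅y⁆; x∈p∧x≢y⇒x∈p-y; x∈p⇒∣p-x∣<∣p∣; p⊂q⇒∣p∣<∣q∣; ⊆-antisym)
open import Data.List using (List; []; _∷_; _++_; length; lookup)
open import Data.List.Membership.Propositional using () renaming (_∈_ to _∈ₗ_; _∉_ to _∉ₗ_)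
open import Data.List.Membership.Propositional.Properties using (∈-++⁺ˡ; ∈-++⁺ʳ; ∈-∃++; ∈-lookup)
open import Data.List.Relation.Unary.Any using (here; there; any?)
open import Data.List.Relation.Unary.All.Properties using (All¬⇒¬Any; ¬Any⇒All¬)
open import Data.List.Relation.Unary.Unique.Propositional using (Unique)
open import Data.List.Relation.Unary.AllPairs using ([]; _∷_)
open import Data.Product using (Σ; _×_; _,_; swap)
open import Data.Sum using (_⊎_; inj₁; inj₂; [_,_]′)
open import Data.Empty using (⊥-elim) renaming (⊥ to Empty)
open import Function using (_∘_)
open import Relation.Nullary using (¬_; yes; no; contradiction)
open import Relation.Binary.PropositionalEquality using (_≡_; _≢_; refl; sym; trans; cong; subst)
open import Function.Bundles using (Equivalence)

open Equivalence

¬¬-pull-Fin : ∀ {n} {P : Fin n → Set} → (∀ x → ¬ ¬ P x) → ¬ ¬ (∀ x → P x)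
¬¬-pull-Fin {zero}  _ k = k (λ ())
¬¬-pull-Fin {suc n} h k = h zero λ p₀ → ¬¬-pull-Fin (h ∘ suc) λ ps → k (∀-cons p₀ ps)

module _ {A : Set} where

  Unique-head : ∀ {x : A} {xs} → Unique (x ∷ xs) → x ∉ₗ xs
  Unique-head (x∉xs ∷ _) = All¬⇒¬Any x∉xs

  Unique-++⁻ʳ : ∀ (xs : List A) {ys} → Unique (xs ++ ys) → Unique ys
  Unique-++⁻ʳ []       u       = u
  Unique-++⁻ʳ (_ ∷ xs) (_ ∷ u) = Unique-++⁻ʳ xs u

  Unique-++-disjoint : ∀ (xs : List A) {ys x} → Unique (xs ++ ys) → x ∈ₗ xs → x ∉ₗ ys
  Unique-++-disjoint (_ ∷ xs) (h ∷ _) (here refl) x∈ys = All¬⇒¬Any h (∈-++⁺ʳ xs x∈ys)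
  Unique-++-disjoint (_ ∷ xs) (_ ∷ u) (there x∈xs) x∈ys = Unique-++-disjoint xs u x∈xs x∈ys

  Unique-lookup-< : ∀ {xs : List A} → Unique xs → ∀ {i j} → i <ᶠ j → lookup xs i ≢ lookup xs j
  Unique-lookup-< {x ∷ xs} (x∉xs ∷ _) {zero}  {suc j} _         eq =
    All¬⇒¬Any x∉xs (subst (_∈ₗ xs) (sym eq) (∈-lookup j))
  Unique-lookup-< {x ∷ xs} (_ ∷ u)    {suc i} {suc j} (s≤s i<j) = Unique-lookup-< u i<j

  lookup-split₂ : ∀ (xs : List A) (i j : Fin (length xs)) → i <ᶠ j →
    Σ (List A) λ P → Σ (List A) λ M → Σ (List A) λ Q →
      xs ≡ P ++ lookup xs i ∷ M ++ lookup xs j ∷ Q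
  lookup-split₂ (x ∷ xs) zero    (suc j) _ with ∈-∃++ (∈-lookup {xs = xs} j)
  ... | M , Q , eq = [] , M , Q , cong (x ∷_) eq
  lookup-split₂ (x ∷ xs) (suc i) (suc j) (s≤s i<j) with lookup-split₂ xs i j i<j
  ... | P , M , Q , eq = x ∷ P , M , Q , cong (x ∷_) eq

⊆⇒⊂⊎≡ : ∀ {n} {p q : Subset n} → p ⊆ q → p ⊂ q ⊎ p ≡ q
⊆⇒⊂⊎≡ {p = p} {q} p⊆q with p ⊂? q
... | yes p⊂q = inj₁ p⊂q
... | no  p⊄q = inj₂ (⊆-antisym p⊆q q⊆p)
  where
  q⊆p : q ⊆ p
  q⊆p {x} x∈q with x ∈? p
  ... | yes x∈p = x∈p
  ... | no  x∉p = contradiction ((λ {y} → p⊆q {y}) , x , x∈q , x∉p) p⊄q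

Bridge : (G : Graph) → Fin (nE G) → Set
Bridge G f = ∀ {x y} → Joins G f x y → ¬ Reach G ⁅ f ⁆ x y

module _ {G : Graph} where

  Joins-sym : ∀ {e a b} → Joins G e a b → Joins G e b a
  Joins-sym (inj₁ p) = inj₂ p
  Joins-sym (inj₂ p) = inj₁ p

  Joins-endpoints : ∀ {e a b y z} → Joins G e a b → Joins G e y z →
                    (a , b) ≡ (y , z) ⊎ (a , b) ≡ (z , y)
  Joins-endpoints (inj₁ p) (inj₁ q) = inj₁ (trans (sym p) q)
  Joins-endpoints (inj₁ p) (inj₂ q) = inj₂ (trans (sym p) q)
  Joins-endpoints (inj₂ p) (inj₁ q) = inj₂ (cong swap (trans (sym p) q))
  Joins-endpoints (inj₂ p) (inj₂ q) = inj₁ (cong swap (trans (sym p) q))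

  Reach-trans : ∀ {S x y z} → Reach G S x y → Reach G S y z → Reach G S x z
  Reach-trans p here             = p
  Reach-trans p (step e q e∉S j) = step e (Reach-trans p q) e∉S j

  Reach-edge : ∀ {S x y} e → e ∉ S → Joins G e x y → Reach G S x y
  Reach-edge e e∉S j = step e here e∉S j

  Reach-sym : ∀ {S x y} → Reach G S x y → Reach G S y x
  Reach-sym here             = here
  Reach-sym (step e p e∉S j) = Reach-trans (Reach-edge e e∉S (Joins-sym j)) (Reach-sym p)

  Walk⇒Reach-without : ∀ {f a b vs es} → Walk G a b vs es → f ∉ₗ es → Reach G ⁅ f ⁆ a b
  Walk⇒Reach-without []           f∉es = here
  Walk⇒Reach-without (step e j w) f∉es =
    Reach-trans (Reach-edge e (f∉es ∘ here ∘ sym ∘ x∈⁅y⁆⇒x≡y _) j)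
                (Walk⇒Reach-without w (f∉es ∘ there))

  Walk-split : ∀ {a b vs} P {e Q} → Walk G a b vs (P ++ e ∷ Q) →
    Σ _ λ x → Σ _ λ y → Σ _ λ vs₁ → Σ _ λ vs₂ →
      Walk G a x vs₁ P × Joins G e x y × Walk G y b vs₂ Q
  Walk-split []      (step e j w) = _ , _ , _ , _ , [] , j , w
  Walk-split (p ∷ P) (step p j w) with Walk-split P w
  ... | x , y , _ , _ , w₁ , jₑ , w₂ = x , y , _ , _ , step p j w₁ , jₑ , w₂

  Walk-head : ∀ {a b vs es} → Walk G a b vs es → a ∈ₗ vs
  Walk-head []           = here refl
  Walk-head (step e j w) = here refl

  Walk-edge-endpoint : ∀ {a b vs es e x y} → Walk G a b vs es → e ∈ₗ es → Joins G e x y → x ∈ₗ vs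
  Walk-edge-endpoint (step e j w) (here refl) jₑ with Joins-endpoints j jₑ
  ... | inj₁ refl = here refl
  ... | inj₂ refl = there (Walk-head w)
  Walk-edge-endpoint (step e j w) (there e∈es) jₑ = there (Walk-edge-endpoint w e∈es jₑ)

  Walk-edges-unique : ∀ {a b vs es} → Walk G a b vs es → Unique vs → Unique es
  Walk-edges-unique []                   _       = []
  Walk-edges-unique {es = e ∷ es} (step e j w) (a∉vs ∷ u) =
    ¬Any⇒All¬ es (λ e∈es → All¬⇒¬Any a∉vs (Walk-edge-endpoint w e∈es j)) ∷ Walk-edges-unique w u

  Path-edges-unique : ∀ {a b es} → Path G a b es → Unique es
  Path-edges-unique (_ , w , u) = Walk-edges-unique w u

  reroute-around : ∀ {f x y S a b} → Joins G f x y → Reach G ⁅ f ⁆ x y →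
                   Reach G S a b → Reach G ⁅ f ⁆ a b
  reroute-around jf r here = here
  reroute-around {f} jf r (step e p _ j) with e ≟ᶠ f
  ... | no e≢f = step e (reroute-around jf r p) (x≢y⇒x∉⁅y⁆ e≢f) j
  ... | yes refl with Joins-endpoints jf j
  ...   | inj₁ refl = Reach-trans (reroute-around jf r p) r
  ...   | inj₂ refl = Reach-trans (reroute-around jf r p) (Reach-sym r)

  tree-edge-bridge : IsTree G → ∀ f → Bridge G f
  tree-edge-bridge (conn , minimal) f jf r = minimal f λ a b → reroute-around jf r (conn a b)

  walk-through-bridge : ∀ {f a b vs es} → Bridge G f → Walk G a b vs es → Unique es →
                        f ∈ₗ es → ¬ Reach G ⁅ f ⁆ a b
  walk-through-bridge {f} bridge w u f∈es r with ∈-∃++ f∈es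
  ... | P , Q , refl with Walk-split P w
  ...   | _ , _ , _ , _ , w₁ , jf , w₂ =
    bridge jf (Reach-trans (Reach-sym (Walk⇒Reach-without w₁ f∉P))
                           (Reach-trans r (Reach-sym (Walk⇒Reach-without w₂ f∉Q))))
    where
    f∉P : f ∉ₗ P
    f∉P f∈P = Unique-++-disjoint P u f∈P (here refl)
    f∉Q : f ∉ₗ Q
    f∉Q = Unique-head (Unique-++⁻ʳ P u)

  -- Crossing fj from c to d would mean c is reached from a without fi, joining the sides of fi.
  near-side-⊆ : ∀ {fi fj a b c d} → Bridge G fi → Joins G fi a b → Joins G fj c d →
                Reach G ⁅ fi ⁆ b c → Reach G ⁅ fj ⁆ a c →
                ∀ {w} → Reach G ⁅ fi ⁆ a w → Reach G ⁅ fj ⁆ c w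
  near-side-⊆ bridge ji jj b→c a→c here = Reach-sym a→c
  near-side-⊆ {fj = fj} bridge ji jj b→c a→c (step e p _ j) with e ≟ᶠ fj
  ... | no e≢fj = step e (near-side-⊆ bridge ji jj b→c a→c p) (x≢y⇒x∉⁅y⁆ e≢fj) j
  ... | yes refl with Joins-endpoints jj j
  ...   | inj₁ refl = ⊥-elim (bridge ji (Reach-trans p (Reach-sym b→c)))
  ...   | inj₂ refl = here

module _ {H : Graph} (bridge : ∀ f → Bridge H f) where

  -- If f were on the root path to v, it would be off the ancestor path v ⇝ u (the root
  -- path to u has distinct edges), which would then join v to u avoiding a bridge of es.
  ancestor-reach-without : ∀ {ρ v u vs es f} → Ancestor H ρ v u → Walk H v u vs es → Unique es →
                           f ∈ₗ es → Reach H ⁅ f ⁆ ρ v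
  ancestor-reach-without {f = f} (es₁ , es₂ , (_ , w₁ , _) , (_ , w₂ , _) , ρ⇝u) w u f∈es
    with any? (f ≟ᶠ_) es₁
  ... | no  f∉es₁ = Walk⇒Reach-without w₁ f∉es₁
  ... | yes f∈es₁ = ⊥-elim (walk-through-bridge (bridge f) w u f∈es
      (Walk⇒Reach-without w₂ (Unique-++-disjoint es₁ (Path-edges-unique ρ⇝u) f∈es₁)))

  walk-sides-nested : ∀ {ρ v u vs} P M Q fi fj →
    Reach H ⁅ fi ⁆ ρ v → Reach H ⁅ fj ⁆ ρ v →
    Walk H v u vs (P ++ fi ∷ M ++ fj ∷ Q) → Unique (P ++ fi ∷ M ++ fj ∷ Q) →
    ∀ {x} → Reach H ⁅ fi ⁆ ρ x → Reach H ⁅ fj ⁆ ρ x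
  walk-sides-nested P M Q fi fj ρ⇝ᵢv ρ⇝ⱼv w u ρ⇝x with Walk-split P w
  ... | a , b , _ , _ , wP , ji , wrest with Walk-split M wrest
  ...   | c , d , _ , _ , wM , jj , _ =
    Reach-trans ρ⇝c (near-side-⊆ (bridge fi) ji jj (Walk⇒Reach-without wM fi∉M) a⇝c
                      (Reach-trans (Reach-sym ρ⇝a) ρ⇝x))
    where
    u₂ : Unique (fi ∷ M ++ fj ∷ Q)
    u₂ = Unique-++⁻ʳ P u
    fi∉P : fi ∉ₗ P
    fi∉P m = Unique-++-disjoint P u m (here refl)
    fj∉P : fj ∉ₗ P
    fj∉P m = Unique-++-disjoint P u m (there (∈-++⁺ʳ M (here refl)))
    fi∉M : fi ∉ₗ M
    fi∉M m = Unique-head u₂ (∈-++⁺ˡ m)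
    fj∉M : fj ∉ₗ M
    fj∉M m with u₂
    ... | _ ∷ u₃ = Unique-++-disjoint M u₃ m (here refl)
    fi≢fj : fi ≢ fj
    fi≢fj eq = Unique-head u₂ (∈-++⁺ʳ M (here eq))
    ρ⇝a : Reach H ⁅ fi ⁆ _ a
    ρ⇝a = Reach-trans ρ⇝ᵢv (Walk⇒Reach-without wP fi∉P)
    a⇝c : Reach H ⁅ fj ⁆ a c
    a⇝c = Reach-trans (Reach-edge fi (x≢y⇒x∉⁅y⁆ fi≢fj) ji) (Walk⇒Reach-without wM fj∉M)
    ρ⇝c : Reach H ⁅ fj ⁆ _ c
    ρ⇝c = Reach-trans (Reach-trans ρ⇝ⱼv (Walk⇒Reach-without wP fj∉P)) a⇝c

  deeper-edge-side-⊆ : ∀ {ρ v u es} → Ancestor H ρ v u → Path H v u es →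
    ∀ {i j} → i <ᶠ j → ∀ {x} → Reach H ⁅ lookup es i ⁆ ρ x → Reach H ⁅ lookup es j ⁆ ρ x
  deeper-edge-side-⊆ {es = es} anc (vs , w , uvs) {i} {j} i<j with lookup-split₂ es i j i<j
  ... | P , M , Q , eq =
    walk-sides-nested P M Q (lookup es i) (lookup es j) (ρ⇝v (∈-lookup i)) (ρ⇝v (∈-lookup j))
      (subst (Walk H _ _ vs) eq w) (subst Unique eq ues)
    where
    ues : Unique es
    ues = Walk-edges-unique w uvs
    ρ⇝v : ∀ {f} → f ∈ₗ es → Reach H ⁅ f ⁆ _ _
    ρ⇝v = ancestor-reach-without anc w ues

module _ {G : Graph} {r : Fin (nV G)} where

  P-closed : ∀ {c s e a b} → IsP G r c s → e ∉ c → Joins G e a b → a ∈ s → b ∈ s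
  P-closed Ps e∉c j a∈s = from (Ps _) λ r⇝b → to (Ps _) a∈s (step _ r⇝b e∉c (Joins-sym {G = G} j))

  -- Otherwise every vertex is reached from r avoiding the two edges c - e by a walk
  -- that never enters P(c), so that G \ c would be connected.
  three-cut-edge-crosses : (∀ S → ∣ S ∣ ≤ 2 → ConnectedWithout G S) →
    ∀ {c s e a b} → IsThreeCut G c → IsP G r c s → e ∈ c → Joins G e a b →
    (a ∈ s → b ∈ s) → (b ∈ s → a ∈ s) → Empty
  three-cut-edge-crosses connected {c} {s} {e} (∣c∣≡3 , disconnected) Ps e∈c je a→b b→a =
    ¬¬-pull-Fin (λ z ¬r⇝z → outside-P (connected (c - e) ∣c-e∣≤2 r z) (from (Ps z) ¬r⇝z))
      λ r⇝ → disconnected λ x y → Reach-trans (Reach-sym (r⇝ x)) (r⇝ y)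
    where
    ∣c-e∣≤2 : ∣ c - e ∣ ≤ 2
    ∣c-e∣≤2 = ≤-pred (subst (∣ c - e ∣ <_) ∣c∣≡3 (x∈p⇒∣p-x∣<∣p∣ e∈c))
    outside-P : ∀ {z} → Reach G (c - e) r z → z ∉ s
    outside-P here r∈s = to (Ps r) r∈s here
    outside-P (step e′ p e′∉c-e j) z∈s with e′ ∈? c
    ... | no e′∉c = outside-P p (P-closed Ps e′∉c (Joins-sym {G = G} j) z∈s)
    ... | yes e′∈c with e′ ≟ᶠ e
    ...   | no e′≢e = e′∉c-e (x∈p∧x≢y⇒x∈p-y e′∈c e′≢e)
    ...   | yes refl with Joins-endpoints {G = G} je j
    ...     | inj₁ refl = outside-P p (b→a z∈s)
    ...     | inj₂ refl = outside-P p (a→b z∈s)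

  three-cut-⊆-of-same-P : (∀ S → ∣ S ∣ ≤ 2 → ConnectedWithout G S) →
    ∀ {c c′ s} → IsThreeCut G c → IsP G r c s → IsP G r c′ s → c ⊆ c′
  three-cut-⊆-of-same-P connected {c′ = c′} cut Ps Ps′ {e} e∈c with e ∈? c′
  ... | yes e∈c′ = e∈c′
  ... | no  e∉c′ = ⊥-elim (three-cut-edge-crosses connected cut Ps e∈c (inj₁ refl)
                            (P-closed Ps′ e∉c′ (inj₁ refl)) (P-closed Ps′ e∉c′ (inj₂ refl)))

  three-cut-determined-by-P : (∀ S → ∣ S ∣ ≤ 2 → ConnectedWithout G S) →
    ∀ {c c′ s} → IsThreeCut G c → IsThreeCut G c′ → IsP G r c s → IsP G r c′ s → c ≡ c′
  three-cut-determined-by-P connected cut cut′ Ps Ps′ =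
    ⊆-antisym (three-cut-⊆-of-same-P connected cut Ps Ps′)
              (three-cut-⊆-of-same-P connected cut′ Ps′ Ps)

  P-⊆-of-nested-tree-sides : (T : CutTree G) → let open CutTree T in
    ∀ {c c′ f f′ s s′} → IsThreeCut G c → IsThreeCut G c′ → φ c ≡ f → φ c′ ≡ f′ →
    IsP G r c s → IsP G r c′ s′ →
    (∀ {x} → Reach H ⁅ f ⁆ (ψ r) x → Reach H ⁅ f′ ⁆ (ψ r) x) → s′ ⊆ s
  P-⊆-of-nested-tree-sides T cut cut′ refl refl Ps Ps′ nested {x} x∈s′ =
    from (Ps x) λ r⇝x → to (Ps′ x) x∈s′
      (from (CutTree.compat T _ cut′ r x) (nested (to (CutTree.compat T _ cut r x) r⇝x)))

lemma6p3 : (G : Graph) → ThreeEdgeConnected G → (r : Fin (nV G)) → (T : CutTree G) →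
    (v u : Fin (nV (CutTree.H T))) → Ancestor (CutTree.H T) (CutTree.ψ T r) v u →
    (es : List (Fin (nE (CutTree.H T)))) → Path (CutTree.H T) v u es →
    (i j : Fin (length es)) → i <ᶠ j →
    (c c' : Subset (nE G)) → IsThreeCut G c → IsThreeCut G c' →
    CutTree.φ T c ≡ lookup es i → CutTree.φ T c' ≡ lookup es j →
    (s s' : Subset (nV G)) → IsP G r c s → IsP G r c' s' →
    ∣ s' ∣ < ∣ s ∣
lemma6p3 G (_ , connected) r T v u anc es path i j i<j c c' cut cut' φc φc' s s' Ps Ps' =
  [ p⊂q⇒∣p∣<∣q∣ , (λ s'≡s → ⊥-elim (distinct-edges (cut-edges-equal s'≡s))) ]′ (⊆⇒⊂⊎≡ s'⊆s)
  where
  open CutTree T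
  s'⊆s : s' ⊆ s
  s'⊆s = P-⊆-of-nested-tree-sides T cut cut' φc φc' Ps Ps'
           (deeper-edge-side-⊆ (tree-edge-bridge isTree) anc path i<j)
  distinct-edges : lookup es i ≢ lookup es j
  distinct-edges = Unique-lookup-< (Path-edges-unique path) i<j
  cut-edges-equal : s' ≡ s → lookup es i ≡ lookup es j
  cut-edges-equal s'≡s = trans (sym φc) (trans (cong φ c≡c') φc')
    where
    c≡c' : c ≡ c'
    c≡c' = three-cut-determined-by-P connected cut cut' Ps (subst (IsP G r c') s'≡s Ps')
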